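{- Let $s,t$ be terms and $\alpha$ a prenaming safe for $s$ and for $t$. Then $s=t$ iff $\alpha(s)=\alpha(t)$; $s$ occurs in $t$ iff $\alpha(s)$ occurs in $\alpha(t)$; and consequently $s,t$ are variable-disjoint iff $\alpha(s),\alpha(t)$ are variable-disjoint.
   Context: Terms are built from a countably infinite set $V$ of variables and function symbols; $\mathrm{vars}(t)$ is the set of variables of $t$; substitutions act homomorphically on terms. A prenaming is a substitution $\alpha$ mapping variables to variables together with a fixed finite set $C^+(\alpha)\supseteq\mathrm{Dom}(\alpha)=\{x:\alpha(x)\neq x\}$ (relaxed core) on which $\alpha$ is injective; $R^+(\alpha)=\alpha(C^+(\alpha))$; $\mathrm{indom}(\alpha)=V\setminus(R^+(\alpha)\setminus C^+(\alpha))$; $\alpha$ is safe for $t$ if $\mathrm{vars}(t)\subseteq\mathrm{indom}(\alpha)$. -}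

module Defs where

open import Data.Nat using (ℕ)
open import Data.List using (List; []; _∷_; map)
open import Data.List.Membership.Propositional using (_∈_; _∉_)
open import Data.Product using (_×_)
open import Relation.Binary.PropositionalEquality using (_≡_; _≢_)
open import Relation.Nullary using (¬_)
open import Data.Empty using (⊥)

-- Variables: V = ℕ (countably infinite). Function symbols: an arbitrary type F
-- (symbols carry no fixed arity constraint; terms are f(t1,...,tn)).
data Term (F : Set) : Set where
  var : ℕ → Term F
  fun : F → List (Term F) → Term F

module _ {F : Set} where

  data _∈vars_ (x : ℕ) : Term F → Set where
    here : x ∈vars var x
    arg  : ∀ {f ts t} → t ∈ ts → x ∈vars t → x ∈vars fun f ts

  data _occursIn_ (s : Term F) : Term F → Set where
    self : s occursIn s
    arg  : ∀ {f ts t} → t ∈ ts → s occursIn t → s occursIn fun f ts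

  VarDisjoint : Term F → Term F → Set
  VarDisjoint s t = ∀ x → x ∈vars s → x ∈vars t → ⊥

  mutual
    rename : (ℕ → ℕ) → Term F → Term F
    rename ρ (var x)    = var (ρ x)
    rename ρ (fun f ts) = fun f (renameList ρ ts)

    renameList : (ℕ → ℕ) → List (Term F) → List (Term F)
    renameList ρ []       = []
    renameList ρ (t ∷ ts) = rename ρ t ∷ renameList ρ ts

-- Prenaming: variable-to-variable map with a finite relaxed core C⁺ ⊇ Dom,
-- on which it is injective.
record Prenaming : Set where
  field
    fn       : ℕ → ℕ
    core     : List ℕ
    dom⊆core : ∀ x → fn x ≢ x → x ∈ core
    injCore  : ∀ x y → x ∈ core → y ∈ core → fn x ≡ fn y → x ≡ y

  range : List ℕ
  range = map fn core

  indom : ℕ → Set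
  indom x = ¬ (x ∈ range × x ∉ core)

open Prenaming public

applyP : {F : Set} → Prenaming → Term F → Term F
applyP α = rename (fn α)

SafeFor : {F : Set} → Prenaming → Term F → Set
SafeFor α t = ∀ x → x ∈vars t → indom α x

-- A prenaming is injective on indom(α): inside its core by definition, outside
-- the core it is the identity, and a variable outside the core that collides
-- with the image of a core variable lies in R⁺ ∖ C⁺, so is not in indom(α).
-- Renaming by a map that is injective on the variables of s and t reflects
-- equality, occurrence and shared variables, which gives all three equivalences.
module Submission where

open import Defs
open import Data.Product using (_×_; _,_; ∃)
open import Relation.Binary.PropositionalEquality
  using (_≡_; refl; sym; trans; cong; cong₂; subst)
open import Function.Bundles using (_⇔_; mk⇔)
open import Data.Nat using (ℕ; _≟_)
open import Data.List using (List; []; _∷_; map)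
open import Data.List.Properties using (∷-injective)
open import Data.List.Membership.Propositional using (_∈_; _∉_)
open import Data.List.Membership.Propositional.Properties using (∈-map⁺; ∈-map⁻)
open import Data.List.Membership.DecPropositional _≟_ using (_∈?_)
open import Data.List.Relation.Unary.All using (All; []; _∷_; tabulate)
open import Relation.Nullary using (yes; no; ¬_)
open import Data.Empty using (⊥-elim)

private
  variable
    F : Set

module _ (α : Prenaming) where

  fn-outside-core : ∀ {x} → x ∉ core α → fn α x ≡ x
  fn-outside-core {x} x∉core with fn α x ≟ x
  ... | yes fx≡x = fx≡x
  ... | no  fx≢x = ⊥-elim (x∉core (dom⊆core α x fx≢x))

  ¬indom-of-collision : ∀ {x y} → x ∉ core α → y ∈ core α →
                        fn α x ≡ fn α y → ¬ indom α x
  ¬indom-of-collision {x} {y} x∉core y∈core fx≡fy x∈indom =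
    x∈indom (subst (_∈ range α) x≡fy (∈-map⁺ (fn α) y∈core) , x∉core)
    where
    x≡fy : fn α y ≡ x
    x≡fy = trans (sym fx≡fy) (fn-outside-core x∉core)

  fn-injective-on-indom : ∀ {x y} → indom α x → indom α y → fn α x ≡ fn α y → x ≡ y
  fn-injective-on-indom {x} {y} x∈indom y∈indom fx≡fy with x ∈? core α | y ∈? core α
  ... | yes x∈core | yes y∈core = injCore α x y x∈core y∈core fx≡fy
  ... | no  x∉core | yes y∈core = ⊥-elim (¬indom-of-collision x∉core y∈core fx≡fy x∈indom)
  ... | yes x∈core | no  y∉core = ⊥-elim (¬indom-of-collision y∉core x∈core (sym fx≡fy) y∈indom)
  ... | no  x∉core | no  y∉core =
    trans (sym (fn-outside-core x∉core)) (trans fx≡fy (fn-outside-core y∉core))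

AllVars : (ℕ → Set) → Term F → Set
AllVars P t = ∀ x → x ∈vars t → P x

AllVars-args : ∀ {P : ℕ → Set} {f : F} {ts} → AllVars P (fun f ts) → All (AllVars P) ts
AllVars-args all = tabulate (λ t∈ts x x∈t → all x (arg t∈ts x∈t))

var-injective : ∀ {x y} → var {F} x ≡ var y → x ≡ y
var-injective refl = refl

fun-injective : ∀ {f g : F} {ss ts} → fun f ss ≡ fun g ts → f ≡ g × ss ≡ ts
fun-injective refl = refl , refl

module _ (ρ : ℕ → ℕ) where

  renameList≡map : (ts : List (Term F)) → renameList ρ ts ≡ map (rename ρ) ts
  renameList≡map []       = refl
  renameList≡map (t ∷ ts) = cong (rename ρ t ∷_) (renameList≡map ts)

  ∈-renameList⁺ : ∀ {t : Term F} {ts} → t ∈ ts → rename ρ t ∈ renameList ρ ts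
  ∈-renameList⁺ {ts = ts} t∈ts =
    subst (_ ∈_) (sym (renameList≡map ts)) (∈-map⁺ (rename ρ) t∈ts)

  ∈-renameList⁻ : ∀ {t′ : Term F} ts → t′ ∈ renameList ρ ts →
                  ∃ λ t → t ∈ ts × t′ ≡ rename ρ t
  ∈-renameList⁻ ts t′∈ = ∈-map⁻ (rename ρ) (subst (_ ∈_) (renameList≡map ts) t′∈)

  ∈vars-rename⁺ : ∀ {x} {t : Term F} → x ∈vars t → ρ x ∈vars rename ρ t
  ∈vars-rename⁺ here            = here
  ∈vars-rename⁺ (arg t∈ts x∈t) = arg (∈-renameList⁺ t∈ts) (∈vars-rename⁺ x∈t)

  ∈vars-rename⁻ : ∀ {y} (t : Term F) → y ∈vars rename ρ t → ∃ λ x → x ∈vars t × ρ x ≡ y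
  ∈vars-rename⁻ (var x)    here = x , here , refl
  ∈vars-rename⁻ (fun f ts) (arg t′∈ y∈t′) with ∈-renameList⁻ ts t′∈
  ... | t , t∈ts , refl with ∈vars-rename⁻ t y∈t′
  ...   | x , x∈t , ρx≡y = x , arg t∈ts x∈t , ρx≡y

  occursIn-rename⁺ : ∀ {s t : Term F} → s occursIn t → rename ρ s occursIn rename ρ t
  occursIn-rename⁺ self             = self
  occursIn-rename⁺ (arg t∈ts s∈t) = arg (∈-renameList⁺ t∈ts) (occursIn-rename⁺ s∈t)

  VarDisjoint-rename⁻ : ∀ {s t : Term F} →
                        VarDisjoint (rename ρ s) (rename ρ t) → VarDisjoint s t
  VarDisjoint-rename⁻ disj x x∈s x∈t = disj (ρ x) (∈vars-rename⁺ x∈s) (∈vars-rename⁺ x∈t)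

  module _ {P : ℕ → Set} (ρ-injective : ∀ {x y} → P x → P y → ρ x ≡ ρ y → x ≡ y) where

    mutual
      rename-injective : ∀ {s t : Term F} → AllVars P s → AllVars P t →
                         rename ρ s ≡ rename ρ t → s ≡ t
      rename-injective {s = var x} {var y} Ps Pt ρx≡ρy =
        cong var (ρ-injective (Ps x here) (Pt y here) (var-injective ρx≡ρy))
      rename-injective {s = fun f ss} {fun g ts} Ps Pt e with fun-injective e
      ... | f≡g , ρss≡ρts =
        cong₂ fun f≡g (renameList-injective (AllVars-args Ps) (AllVars-args Pt) ρss≡ρts)

      renameList-injective : ∀ {ss ts : List (Term F)} → All (AllVars P) ss → All (AllVars P) ts →
                             renameList ρ ss ≡ renameList ρ ts → ss ≡ ts
      renameList-injective {ss = []} {[]} [] [] _ = refl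
      renameList-injective {ss = s ∷ ss} {t ∷ ts} (Ps ∷ Pss) (Pt ∷ Pts) e with ∷-injective e
      ... | ρs≡ρt , ρss≡ρts =
        cong₂ _∷_ (rename-injective Ps Pt ρs≡ρt) (renameList-injective Pss Pts ρss≡ρts)

    -- The occurrence is generalised to an arbitrary t′ = rename ρ t so that
    -- induction on it is possible.
    occursIn-rename⁻ : ∀ {s t : Term F} → AllVars P s → AllVars P t →
                       rename ρ s occursIn rename ρ t → s occursIn t
    occursIn-rename⁻ {s = s} {t} Ps Pt ρs∈ρt = go ρs∈ρt t refl Pt
      where
      go : ∀ {t′} → rename ρ s occursIn t′ → ∀ t → t′ ≡ rename ρ t → AllVars P t → s occursIn t
      go self t ρs≡ρt Pt = subst (s occursIn_) (rename-injective Ps Pt ρs≡ρt) self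
      go (arg t′∈ ρs∈t′) (fun g ts) refl Pt with ∈-renameList⁻ ts t′∈
      ... | u , u∈ts , t′≡ρu = arg u∈ts (go ρs∈t′ u t′≡ρu (λ x x∈u → Pt x (arg u∈ts x∈u)))

    VarDisjoint-rename⁺ : ∀ {s t : Term F} → AllVars P s → AllVars P t →
                          VarDisjoint s t → VarDisjoint (rename ρ s) (rename ρ t)
    VarDisjoint-rename⁺ {s = s} {t} Ps Pt disj y y∈ρs y∈ρt
      with ∈vars-rename⁻ s y∈ρs | ∈vars-rename⁻ t y∈ρt
    ... | x , x∈s , ρx≡y | x′ , x′∈t , ρx′≡y
      with ρ-injective (Ps x x∈s) (Pt x′ x′∈t) (trans ρx≡y (sym ρx′≡y))
    ...   | refl = disj x x∈s x′∈t

mainTheorem15 : {F : Set} (α : Prenaming) (s t : Term F) →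
                SafeFor α s → SafeFor α t →
                ((s ≡ t) ⇔ (applyP α s ≡ applyP α t))
                × ((s occursIn t) ⇔ (applyP α s occursIn applyP α t))
                × (VarDisjoint s t ⇔ VarDisjoint (applyP α s) (applyP α t))
mainTheorem15 α s t safe-s safe-t =
  mk⇔ (cong (applyP α)) (rename-injective (fn α) ρ-inj safe-s safe-t) ,
  mk⇔ (occursIn-rename⁺ (fn α)) (occursIn-rename⁻ (fn α) ρ-inj safe-s safe-t) ,
  mk⇔ (VarDisjoint-rename⁺ (fn α) ρ-inj safe-s safe-t) (VarDisjoint-rename⁻ (fn α))
  where
  ρ-inj : ∀ {x y} → indom α x → indom α y → fn α x ≡ fn α y → x ≡ y
  ρ-inj = fn-injective-on-indom α
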